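{- Every $a\in\mathrm{QSym}$ and $b\in\mathrm{QSym}$ satisfy $a\prec b\in\mathrm{QSym}$ and $a\triangleright b\in\mathrm{QSym}$.
   Context: Let $\mathbf{k}$ be a commutative ring and $\mathbf{k}[[x_1,x_2,\ldots]]$ the ring of formal power series in commuting indeterminates, with the product topology. A monomial is $x_1^{a_1}x_2^{a_2}\cdots$ with finitely many nonzero exponents; $\mathrm{Supp}\,\mathfrak m=\{i:a_i>0\}$; conventions $\min\varnothing=\infty$, $\max\varnothing=0$. $\prec$ is the unique $\mathbf{k}$-bilinear continuous binary operation with $\mathfrak m\prec\mathfrak n=\mathfrak m\mathfrak n$ if $\min(\mathrm{Supp}\,\mathfrak m)<\min(\mathrm{Supp}\,\mathfrak n)$ and $0$ otherwise; $\triangleright$ is the unique $\mathbf{k}$-bilinear continuous binary operation with $\mathfrak m\triangleright\mathfrak n=\mathfrak m\mathfrak n$ if $\max(\mathrm{Supp}\,\mathfrak m)\le\min(\mathrm{Supp}\,\mathfrak n)$ and $0$ otherwise. Two monomials are pack-equivalent if they are of the forms $x_{i_1}^{\alpha_1}\cdots x_{i_\ell}^{\alpha_\ell}$ and $x_{j_1}^{\alpha_1}\cdots x_{j_\ell}^{\alpha_\ell}$ with positive $\alpha_p$, $i_1<\cdots<i_\ell$ and $j_1<\cdots<j_\ell$. $\mathrm{QSym}$ is the set of power series of bounded degree (some $N$ such that all monomials of degree $>N$ have coefficient $0$) in which any two pack-equivalent monomials have equal coefficients. -}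

module Defs where

open import Level using (Level)
open import Data.Nat using (ℕ; zero; suc; _∸_; _<ᵇ_; _≤ᵇ_; _<_)
open import Data.Bool using (Bool; true; false; if_then_else_)
open import Data.Product using (_×_; _,_; proj₁; proj₂; Σ; ∃)
open import Data.List using (List; []; _∷_; map; concatMap; replicate; _++_; upTo; foldr)
open import Data.Nat.ListAction using (sum)
open import Relation.Binary.PropositionalEquality using (_≡_)
open import Algebra.Bundles using (CommutativeRing)

-- A monomial x_{i_1}^{α_1} ⋯ x_{i_ℓ}^{α_ℓ} (i_1 < ⋯ < i_ℓ, α_p ≥ 1, indices ≥ 1)
-- is encoded canonically (bijectively) as the list
--   (i_1 ∸ 1 , α_1 ∸ 1) ∷ (i_2 ∸ i_1 ∸ 1 , α_2 ∸ 1) ∷ ⋯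
-- i.e. each entry (g , e) means: skip g variables, then the next variable
-- occurs with exponent suc e.
Monomial : Set
Monomial = List (ℕ × ℕ)

degree : Monomial → ℕ
degree m = sum (map (λ p → suc (proj₂ p)) m)

toDense : Monomial → List ℕ
toDense [] = []
toDense ((g , e) ∷ r) = replicate g 0 ++ (suc e ∷ toDense r)

fromDense′ : ℕ → List ℕ → Monomial
fromDense′ g [] = []
fromDense′ g (zero ∷ r) = fromDense′ (suc g) r
fromDense′ g (suc e ∷ r) = (g , e) ∷ fromDense′ 0 r

fromDense : List ℕ → Monomial
fromDense = fromDense′ 0

splitsD : List ℕ → List (List ℕ × List ℕ)
splitsD [] = ([] , []) ∷ []
splitsD (a ∷ r) =
  concatMap (λ i → map (λ xy → (i ∷ proj₁ xy) , ((a ∸ i) ∷ proj₂ xy)) (splitsD r))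
            (upTo (suc a))

factorizations : Monomial → List (Monomial × Monomial)
factorizations m = map (λ xy → fromDense (proj₁ xy) , fromDense (proj₂ xy)) (splitsD (toDense m))

-- min(Supp p) < min(Supp q), with min ∅ = ∞
precCond : Monomial → Monomial → Bool
precCond [] _ = false
precCond (_ ∷ _) [] = true
precCond ((g , _) ∷ _) ((h , _) ∷ _) = g <ᵇ h

-- max index in the support (0 for the empty monomial); indices are 1-based
maxSupp : Monomial → ℕ
maxSupp m = sum (map (λ p → suc (proj₁ p)) m)

-- max(Supp p) ≤ min(Supp q), with max ∅ = 0 and min ∅ = ∞
triCond : Monomial → Monomial → Bool
triCond [] _ = true
triCond (_ ∷ _) [] = true
triCond p@(_ ∷ _) ((h , _) ∷ _) = maxSupp p ≤ᵇ suc h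

module _ {c ℓ : Level} (R : CommutativeRing c ℓ) where
  open CommutativeRing R

  PowerSeries : Set c
  PowerSeries = Monomial → Carrier

  -- the continuous bilinear extension of an operation on monomials given by
  -- m ⋆ n = (if cond m n then m n else 0): coefficient of m is a finite sum
  -- over the factorizations of m
  bilinExt : (Monomial → Monomial → Bool) → PowerSeries → PowerSeries → PowerSeries
  bilinExt cond a b m =
    foldr (λ pq acc → (if cond (proj₁ pq) (proj₂ pq) then a (proj₁ pq) * b (proj₂ pq) else 0#) + acc)
          0# (factorizations m)

  _≺_ : PowerSeries → PowerSeries → PowerSeries
  _≺_ = bilinExt precCond

  _▷_ : PowerSeries → PowerSeries → PowerSeries
  _▷_ = bilinExt triCond

  PackEquiv : Monomial → Monomial → Set
  PackEquiv m n = map proj₂ m ≡ map proj₂ n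

  BoundedDegree : PowerSeries → Set ℓ
  BoundedDegree a = ∃ λ N → ∀ m → N < degree m → a m ≈ 0#

  QSym : PowerSeries → Set ℓ
  QSym a = BoundedDegree a × (∀ m n → PackEquiv m n → a m ≈ a n)

-- A monomial is determined by its dense exponent vector, and two monomials are
-- pack-equivalent exactly when their dense vectors agree after deleting zero
-- entries.  Inserting a zero entry into a vector inserts a zero column into
-- every way of splitting it as a sum of two vectors, so the factorizations of
-- pack-equivalent monomials correspond one to one.  Corresponding factors are
-- pack-equivalent, and both conditions min Supp p < min Supp q and
-- max Supp p ≤ min Supp q are unchanged by zero columns; hence the
-- coefficients of a ≺ b and a ▷ b at pack-equivalent monomials are sums of
-- equal terms.  The degree bound is N_a + N_b, since deg p + deg q = deg m.
module Submission where

open import Defs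
open import Level using (Level)
open import Data.Nat using (ℕ; zero; suc; _+_; _∸_; _<ᵇ_; _≤ᵇ_; _≤_; _<_; z≤n; s≤s; _<?_)
open import Data.Nat.Properties
  using (≤-refl; ≤-reflexive; <⇒≤; ≤⇒≯; ≮⇒≥; m≤n⇒m≤1+n; m<m+n; +-suc; +-identityʳ; +-mono-≤; m+[n∸m]≡n;
         +-commutativeSemigroup)
open import Algebra.Properties.CommutativeSemigroup +-commutativeSemigroup using (interchange)
open import Data.Nat.ListAction using (sum)
open import Data.Bool using (Bool; true; false; if_then_else_)
open import Data.Product using (_×_; _,_; proj₁; proj₂; uncurry)
open import Data.Sum using (_⊎_; inj₁; inj₂)
open import Data.List using (List; []; _∷_; map; concatMap; replicate; _++_; upTo; foldr)
open import Data.List.Properties using (∷-injective)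
open import Data.List.Relation.Unary.All as All using (All; []; _∷_)
open import Data.List.Relation.Unary.All.Properties as All using (all-upTo)
open import Data.List.Relation.Binary.Pointwise as Pointwise using (Pointwise; []; _∷_)
open import Relation.Binary.PropositionalEquality
open import Relation.Nullary using (yes; no; contradiction)
open import Algebra.Bundles using (CommutativeRing)

private
  variable
    x y x′ y′ d d′ : List ℕ
    L L′ : List (List ℕ × List ℕ)

<⇒<ᵇ≡true : ∀ m n → m < n → (m <ᵇ n) ≡ true
<⇒<ᵇ≡true zero    (suc n) _         = refl
<⇒<ᵇ≡true (suc m) (suc n) (s≤s m<n) = <⇒<ᵇ≡true m n m<n

≥⇒<ᵇ≡false : ∀ m n → n ≤ m → (m <ᵇ n) ≡ false
≥⇒<ᵇ≡false m       zero    _         = refl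
≥⇒<ᵇ≡false (suc m) (suc n) (s≤s n≤m) = ≥⇒<ᵇ≡false m n n≤m

≤⇒≤ᵇ≡true : ∀ m n → m ≤ n → (m ≤ᵇ n) ≡ true
≤⇒≤ᵇ≡true zero    n _   = refl
≤⇒≤ᵇ≡true (suc m) n m<n = <⇒<ᵇ≡true m n m<n

>⇒≤ᵇ≡false : ∀ m n → n < m → (m ≤ᵇ n) ≡ false
>⇒≤ᵇ≡false (suc m) n (s≤s n≤m) = ≥⇒<ᵇ≡false m n n≤m

+-<-split : ∀ m n p q → m + n < p + q → m < p ⊎ n < q
+-<-split m n p q lt with m <? p | n <? q
... | yes m<p | _       = inj₁ m<p
... | no  _   | yes n<q = inj₂ n<q
... | no  m≮p | no  n≮q = contradiction lt (≤⇒≯ (+-mono-≤ (≮⇒≥ m≮p) (≮⇒≥ n≮q)))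

allZero : List ℕ → Bool
allZero []          = true
allZero (zero  ∷ x) = allZero x
allZero (suc _ ∷ x) = false

precDense : List ℕ → List ℕ → Bool
precDense []          _           = false
precDense (zero  ∷ x) []          = precDense x []
precDense (suc _ ∷ x) []          = true
precDense (zero  ∷ x) (zero  ∷ y) = precDense x y
precDense (zero  ∷ x) (suc _ ∷ y) = false
precDense (suc _ ∷ x) (zero  ∷ y) = true
precDense (suc _ ∷ x) (suc _ ∷ y) = false

triDense : List ℕ → List ℕ → Bool
triDense []      _           = true
triDense (_ ∷ x) []          = true
triDense (_ ∷ x) (zero  ∷ y) = triDense x y
triDense (_ ∷ x) (suc _ ∷ y) = allZero x

packedExponents : List ℕ → List ℕ
packedExponents []          = []
packedExponents (zero  ∷ x) = packedExponents x
packedExponents (suc e ∷ x) = e ∷ packedExponents x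

map-proj₂-fromDense′ : ∀ g x → map proj₂ (fromDense′ g x) ≡ packedExponents x
map-proj₂-fromDense′ g []          = refl
map-proj₂-fromDense′ g (zero  ∷ x) = map-proj₂-fromDense′ (suc g) x
map-proj₂-fromDense′ g (suc e ∷ x) = cong (e ∷_) (map-proj₂-fromDense′ 0 x)

degree-fromDense′ : ∀ g x → degree (fromDense′ g x) ≡ sum x
degree-fromDense′ g []          = refl
degree-fromDense′ g (zero  ∷ x) = degree-fromDense′ (suc g) x
degree-fromDense′ g (suc e ∷ x) = cong (suc e +_) (degree-fromDense′ 0 x)

sum-toDense : ∀ m → sum (toDense m) ≡ degree m
sum-toDense []            = refl
sum-toDense ((g , e) ∷ m) = trans (sum-replicate-0 g) (cong (suc e +_) (sum-toDense m))
  where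
  sum-replicate-0 : ∀ g → sum (replicate g 0 ++ suc e ∷ toDense m) ≡ suc e + sum (toDense m)
  sum-replicate-0 zero    = refl
  sum-replicate-0 (suc g) = sum-replicate-0 g

fromDense′-allZero : ∀ g x → allZero x ≡ true → fromDense′ g x ≡ []
fromDense′-allZero g []          _  = refl
fromDense′-allZero g (zero ∷ x)  az = fromDense′-allZero (suc g) x az

precCond-fromDense′-[] : ∀ g x → precCond (fromDense′ g x) [] ≡ precDense x []
precCond-fromDense′-[] g []          = refl
precCond-fromDense′-[] g (zero  ∷ x) = precCond-fromDense′-[] (suc g) x
precCond-fromDense′-[] g (suc e ∷ x) = refl

precCond-fromDense′-later : ∀ g h x j m → g < h → precCond (fromDense′ h x) ((g , j) ∷ m) ≡ false
precCond-fromDense′-later g h []          j m g<h = refl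
precCond-fromDense′-later g h (zero  ∷ x) j m g<h = precCond-fromDense′-later g (suc h) x j m (m≤n⇒m≤1+n g<h)
precCond-fromDense′-later g h (suc e ∷ x) j m g<h = ≥⇒<ᵇ≡false h g (<⇒≤ g<h)

precCond-fromDense′-earlier : ∀ g h i m y → g < h → precCond ((g , i) ∷ m) (fromDense′ h y) ≡ true
precCond-fromDense′-earlier g h i m []          g<h = refl
precCond-fromDense′-earlier g h i m (zero  ∷ y) g<h = precCond-fromDense′-earlier g (suc h) i m y (m≤n⇒m≤1+n g<h)
precCond-fromDense′-earlier g h i m (suc e ∷ y) g<h = <⇒<ᵇ≡true g h g<h

precCond-fromDense′ : ∀ g x y → precCond (fromDense′ g x) (fromDense′ g y) ≡ precDense x y
precCond-fromDense′ g []          y           = refl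
precCond-fromDense′ g (a ∷ x)     []          = precCond-fromDense′-[] g (a ∷ x)
precCond-fromDense′ g (zero  ∷ x) (zero  ∷ y) = precCond-fromDense′ (suc g) x y
precCond-fromDense′ g (zero  ∷ x) (suc j ∷ y) = precCond-fromDense′-later g (suc g) x j _ ≤-refl
precCond-fromDense′ g (suc i ∷ x) (zero  ∷ y) = precCond-fromDense′-earlier g (suc g) i _ y ≤-refl
precCond-fromDense′ g (suc i ∷ x) (suc j ∷ y) = ≥⇒<ᵇ≡false g g ≤-refl

≤ᵇminSupp : ℕ → Monomial → Bool
≤ᵇminSupp M []            = true
≤ᵇminSupp M ((h , _) ∷ _) = M ≤ᵇ suc h

triCond-maxSupp : ∀ p q → triCond p q ≡ ≤ᵇminSupp (maxSupp p) q
triCond-maxSupp []      []      = refl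
triCond-maxSupp []      (_ ∷ _) = refl
triCond-maxSupp (_ ∷ _) []      = refl
triCond-maxSupp (_ ∷ _) (_ ∷ _) = refl

maxSupp-fromDense′ : ∀ g x → allZero x ≡ false → maxSupp (fromDense′ g x) ≡ g + maxSupp (fromDense x)
maxSupp-fromDense′ g (zero ∷ x) nz = begin
  maxSupp (fromDense′ (suc g) x)  ≡⟨ maxSupp-fromDense′ (suc g) x nz ⟩
  suc g + maxSupp (fromDense x)   ≡⟨ +-suc g _ ⟨
  g + suc (maxSupp (fromDense x)) ≡⟨ cong (g +_) (maxSupp-fromDense′ 1 x nz) ⟨
  g + maxSupp (fromDense′ 1 x)    ∎
  where open ≡-Reasoning
maxSupp-fromDense′ g (suc e ∷ x) _ = sym (+-suc g _)

maxSupp-fromDense-pos : ∀ x → allZero x ≡ false → 0 < maxSupp (fromDense x)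
maxSupp-fromDense-pos (zero ∷ x) nz = subst (0 <_) (sym (maxSupp-fromDense′ 1 x nz)) (s≤s z≤n)
maxSupp-fromDense-pos (suc e ∷ x) _ = s≤s z≤n

≤ᵇminSupp-fromDense′ : ∀ M h y → M ≤ suc h → ≤ᵇminSupp M (fromDense′ h y) ≡ true
≤ᵇminSupp-fromDense′ M h []          M≤h = refl
≤ᵇminSupp-fromDense′ M h (zero  ∷ y) M≤h = ≤ᵇminSupp-fromDense′ M (suc h) y (m≤n⇒m≤1+n M≤h)
≤ᵇminSupp-fromDense′ M h (suc e ∷ y) M≤h = ≤⇒≤ᵇ≡true M (suc h) M≤h

triDense-allZero : ∀ x y → allZero x ≡ true → triDense x y ≡ true
triDense-allZero []         y           _  = refl
triDense-allZero (zero ∷ x) []          _  = refl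
triDense-allZero (zero ∷ x) (zero  ∷ y) az = triDense-allZero x y az
triDense-allZero (zero ∷ x) (suc _ ∷ y) az = az

maxSupp-fromDense′-≤ᵇ : ∀ g a x → (maxSupp (fromDense′ g (a ∷ x)) ≤ᵇ suc g) ≡ allZero x
maxSupp-fromDense′-≤ᵇ g zero x with allZero x in az
... | true  rewrite fromDense′-allZero (suc g) x az = refl
... | false rewrite maxSupp-fromDense′ (suc g) x az =
  >⇒≤ᵇ≡false _ _ (m<m+n (suc g) (maxSupp-fromDense-pos x az))
maxSupp-fromDense′-≤ᵇ g (suc i) x with allZero x in az
... | true  rewrite fromDense′-allZero 0 x az = ≤⇒≤ᵇ≡true _ _ (≤-reflexive (+-identityʳ (suc g)))
... | false = >⇒≤ᵇ≡false _ _ (m<m+n (suc g) (maxSupp-fromDense-pos x az))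

≤ᵇminSupp-maxSupp-fromDense′ : ∀ g x y → ≤ᵇminSupp (maxSupp (fromDense′ g x)) (fromDense′ g y) ≡ triDense x y
≤ᵇminSupp-maxSupp-fromDense′ g []          y           = ≤ᵇminSupp-fromDense′ 0 g y z≤n
≤ᵇminSupp-maxSupp-fromDense′ g (a ∷ x)     []          = refl
≤ᵇminSupp-maxSupp-fromDense′ g (zero  ∷ x) (zero  ∷ y) = ≤ᵇminSupp-maxSupp-fromDense′ (suc g) x y
≤ᵇminSupp-maxSupp-fromDense′ g (suc i ∷ x) (zero  ∷ y) with allZero x in az
... | true  rewrite fromDense′-allZero 0 x az =
  trans (≤ᵇminSupp-fromDense′ (suc g + 0) (suc g) y (m≤n⇒m≤1+n (≤-reflexive (+-identityʳ (suc g)))))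
        (sym (triDense-allZero x y az))
... | false rewrite sym (maxSupp-fromDense′ (suc g) x az) = ≤ᵇminSupp-maxSupp-fromDense′ (suc g) x y
≤ᵇminSupp-maxSupp-fromDense′ g (a ∷ x) (suc j ∷ y) = maxSupp-fromDense′-≤ᵇ g a x

triCond-fromDense′ : ∀ g x y → triCond (fromDense′ g x) (fromDense′ g y) ≡ triDense x y
triCond-fromDense′ g x y = trans (triCond-maxSupp (fromDense′ g x) (fromDense′ g y)) (≤ᵇminSupp-maxSupp-fromDense′ g x y)

data ZeroPadded : List ℕ → List ℕ → Set where
  []        : ZeroPadded [] []
  pad-left  : ZeroPadded d d′ → ZeroPadded (0 ∷ d) d′
  pad-right : ZeroPadded d d′ → ZeroPadded d (0 ∷ d′)
  keep      : ∀ a → ZeroPadded d d′ → ZeroPadded (a ∷ d) (a ∷ d′)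

pad-left-replicate : ∀ g → ZeroPadded d d′ → ZeroPadded (replicate g 0 ++ d) d′
pad-left-replicate zero    p = p
pad-left-replicate (suc g) p = pad-left (pad-left-replicate g p)

pad-right-replicate : ∀ g → ZeroPadded d d′ → ZeroPadded d (replicate g 0 ++ d′)
pad-right-replicate zero    p = p
pad-right-replicate (suc g) p = pad-right (pad-right-replicate g p)

packEquiv⇒zeroPadded : ∀ m n → map proj₂ m ≡ map proj₂ n → ZeroPadded (toDense m) (toDense n)
packEquiv⇒zeroPadded []            []            _  = []
packEquiv⇒zeroPadded ((g , a) ∷ m) ((h , b) ∷ n) eq with ∷-injective eq
... | refl , eq′ = pad-left-replicate g (pad-right-replicate h (keep (suc a) (packEquiv⇒zeroPadded m n eq′)))

packedExponents-zeroPadded : ZeroPadded d d′ → packedExponents d ≡ packedExponents d′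
packedExponents-zeroPadded []               = refl
packedExponents-zeroPadded (pad-left p)     = packedExponents-zeroPadded p
packedExponents-zeroPadded (pad-right p)    = packedExponents-zeroPadded p
packedExponents-zeroPadded (keep zero p)    = packedExponents-zeroPadded p
packedExponents-zeroPadded (keep (suc e) p) = cong (e ∷_) (packedExponents-zeroPadded p)

allZero-zeroPadded : ZeroPadded d d′ → allZero d ≡ allZero d′
allZero-zeroPadded []               = refl
allZero-zeroPadded (pad-left p)     = allZero-zeroPadded p
allZero-zeroPadded (pad-right p)    = allZero-zeroPadded p
allZero-zeroPadded (keep zero p)    = allZero-zeroPadded p
allZero-zeroPadded (keep (suc e) p) = refl

toFactors : List ℕ × List ℕ → Monomial × Monomial
toFactors s = fromDense (proj₁ s) , fromDense (proj₂ s)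

data ColumnPadded : List ℕ × List ℕ → List ℕ × List ℕ → Set where
  []        : ColumnPadded ([] , []) ([] , [])
  pad-left  : ∀ {s} → ColumnPadded (x , y) s → ColumnPadded (0 ∷ x , 0 ∷ y) s
  pad-right : ∀ {s} → ColumnPadded s (x , y) → ColumnPadded s (0 ∷ x , 0 ∷ y)
  keep      : ∀ i j → ColumnPadded (x , y) (x′ , y′) → ColumnPadded (i ∷ x , j ∷ y) (i ∷ x′ , j ∷ y′)

columnPadded⇒zeroPadded : ColumnPadded (x , y) (x′ , y′) → ZeroPadded x x′ × ZeroPadded y y′
columnPadded⇒zeroPadded []            = [] , []
columnPadded⇒zeroPadded (pad-left c)  = let p , q = columnPadded⇒zeroPadded c in pad-left p , pad-left q
columnPadded⇒zeroPadded (pad-right c) = let p , q = columnPadded⇒zeroPadded c in pad-right p , pad-right q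
columnPadded⇒zeroPadded (keep i j c)  = let p , q = columnPadded⇒zeroPadded c in keep i p , keep j q

precDense-columnPadded : ColumnPadded (x , y) (x′ , y′) → precDense x y ≡ precDense x′ y′
precDense-columnPadded []                       = refl
precDense-columnPadded (pad-left c)             = precDense-columnPadded c
precDense-columnPadded (pad-right c)            = precDense-columnPadded c
precDense-columnPadded (keep zero    zero c)    = precDense-columnPadded c
precDense-columnPadded (keep zero    (suc j) c) = refl
precDense-columnPadded (keep (suc i) zero c)    = refl
precDense-columnPadded (keep (suc i) (suc j) c) = refl

triDense-columnPadded : ColumnPadded (x , y) (x′ , y′) → triDense x y ≡ triDense x′ y′
triDense-columnPadded []                 = refl
triDense-columnPadded (pad-left c)       = triDense-columnPadded c
triDense-columnPadded (pad-right c)      = triDense-columnPadded c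
triDense-columnPadded (keep i zero c)    = triDense-columnPadded c
triDense-columnPadded (keep i (suc j) c) = allZero-zeroPadded (proj₁ (columnPadded⇒zeroPadded c))

extend : ℕ → ℕ → List ℕ × List ℕ → List ℕ × List ℕ
extend a i xy = (i ∷ proj₁ xy) , ((a ∸ i) ∷ proj₂ xy)


pad-left-extend : Pointwise ColumnPadded L L′ → Pointwise ColumnPadded (map (extend 0 0) L ++ []) L′
pad-left-extend []       = []
pad-left-extend (c ∷ cs) = pad-left c ∷ pad-left-extend cs

pad-right-extend : Pointwise ColumnPadded L L′ → Pointwise ColumnPadded L (map (extend 0 0) L′ ++ [])
pad-right-extend []       = []
pad-right-extend (c ∷ cs) = pad-right c ∷ pad-right-extend cs

keep-extend : ∀ a is → Pointwise ColumnPadded L L′ →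
  Pointwise ColumnPadded (concatMap (λ i → map (extend a i) L) is) (concatMap (λ i → map (extend a i) L′) is)
keep-extend a []       cs = []
keep-extend a (i ∷ is) cs =
  Pointwise.++⁺ (Pointwise.map⁺ _ _ (Pointwise.map (keep i (a ∸ i)) cs)) (keep-extend a is cs)

splitsD-padded : ZeroPadded d d′ → Pointwise ColumnPadded (splitsD d) (splitsD d′)
splitsD-padded []            = [] ∷ []
splitsD-padded (pad-left p)  = pad-left-extend (splitsD-padded p)
splitsD-padded (pad-right p) = pad-right-extend (splitsD-padded p)
splitsD-padded (keep a p)    = keep-extend a (upTo (suc a)) (splitsD-padded p)

splitsD-sum : ∀ d → All (λ s → sum (proj₁ s) + sum (proj₂ s) ≡ sum d) (splitsD d)
splitsD-sum []      = refl ∷ []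
splitsD-sum (a ∷ d) =
  All.concat⁺ (All.map⁺ (All.map (λ i<1+a → All.map⁺ (All.map (extend-sum i<1+a) (splitsD-sum d))) (all-upTo (suc a))))
  where
  extend-sum : ∀ {i u v} → i < suc a → u + v ≡ sum d → (i + u) + ((a ∸ i) + v) ≡ a + sum d
  extend-sum {i} {u} {v} (s≤s i≤a) eq = trans (interchange i u (a ∸ i) v) (cong₂ _+_ (m+[n∸m]≡n i≤a) eq)

factorizations-degree : ∀ m → All (λ pq → degree (proj₁ pq) + degree (proj₂ pq) ≡ degree m) (factorizations m)
factorizations-degree m = All.map⁺ (All.map (λ {s} → degree-factors {s}) (splitsD-sum (toDense m)))
  where
  degree-factors : ∀ {s} → sum (proj₁ s) + sum (proj₂ s) ≡ sum (toDense m) →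
                   degree (fromDense (proj₁ s)) + degree (fromDense (proj₂ s)) ≡ degree m
  degree-factors {x , y} eq =
    trans (cong₂ _+_ (degree-fromDense′ 0 x) (degree-fromDense′ 0 y)) (trans eq (sum-toDense m))

RespectsPadding : (Monomial → Monomial → Bool) → Set
RespectsPadding cond = ∀ {s s′} → ColumnPadded s s′ → uncurry cond (toFactors s) ≡ uncurry cond (toFactors s′)

precCond-respectsPadding : RespectsPadding precCond
precCond-respectsPadding {x , y} {x′ , y′} c =
  trans (precCond-fromDense′ 0 x y) (trans (precDense-columnPadded c) (sym (precCond-fromDense′ 0 x′ y′)))

triCond-respectsPadding : RespectsPadding triCond
triCond-respectsPadding {x , y} {x′ , y′} c =
  trans (triCond-fromDense′ 0 x y) (trans (triDense-columnPadded c) (sym (triCond-fromDense′ 0 x′ y′)))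

zeroPadded⇒packEquiv : ZeroPadded d d′ → map proj₂ (fromDense d) ≡ map proj₂ (fromDense d′)
zeroPadded⇒packEquiv {d} {d′} p =
  trans (map-proj₂-fromDense′ 0 d) (trans (packedExponents-zeroPadded p) (sym (map-proj₂-fromDense′ 0 d′)))

SimilarFactors : (Monomial → Monomial → Bool) → Monomial × Monomial → Monomial × Monomial → Set
SimilarFactors cond (p , q) (p′ , q′) = map proj₂ p ≡ map proj₂ p′ × map proj₂ q ≡ map proj₂ q′ × cond p q ≡ cond p′ q′

factorizations-packEquiv : ∀ {cond} → RespectsPadding cond → ∀ m n → map proj₂ m ≡ map proj₂ n →
  Pointwise (SimilarFactors cond) (factorizations m) (factorizations n)
factorizations-packEquiv {cond} respects m n eq =
  Pointwise.map⁺ toFactors toFactors (Pointwise.map similar (splitsD-padded (packEquiv⇒zeroPadded m n eq)))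
  where
  similar : ∀ {s s′} → ColumnPadded s s′ → SimilarFactors cond (toFactors s) (toFactors s′)
  similar c = let p , q = columnPadded⇒zeroPadded c in zeroPadded⇒packEquiv p , zeroPadded⇒packEquiv q , respects c

module _ {c ℓ : Level} (R : CommutativeRing c ℓ) where
  open CommutativeRing R
    using (Carrier; _≈_; 0#; +-cong; *-cong; *-congˡ; *-congʳ; zeroˡ; zeroʳ)
    renaming (+-identityˡ to +ᴿ-identityˡ; _+_ to _+ᴿ_; _*_ to _*ᴿ_; refl to ≈-refl; trans to ≈-trans)

  term : (Monomial → Monomial → Bool) → PowerSeries R → PowerSeries R → Monomial × Monomial → Carrier
  term cond a b pq = if cond (proj₁ pq) (proj₂ pq) then a (proj₁ pq) *ᴿ b (proj₂ pq) else 0#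

  PackInvariant : PowerSeries R → Set ℓ
  PackInvariant a = ∀ m n → PackEquiv R m n → a m ≈ a n

  private
    sumMap : ∀ {A : Set} → (A → Carrier) → List A → Carrier
    sumMap f = foldr (λ x acc → f x +ᴿ acc) 0#

    sumMap-cong : ∀ {A B : Set} {f : A → Carrier} {g : B → Carrier} {xs ys} →
                  Pointwise (λ x y → f x ≈ g y) xs ys → sumMap f xs ≈ sumMap g ys
    sumMap-cong []          = ≈-refl
    sumMap-cong (fx≈gy ∷ r) = +-cong fx≈gy (sumMap-cong r)

    sumMap-zero : ∀ {A : Set} {f : A → Carrier} {xs} → All (λ x → f x ≈ 0#) xs → sumMap f xs ≈ 0#
    sumMap-zero []           = ≈-refl
    sumMap-zero (fx≈0 ∷ all) = ≈-trans (+-cong fx≈0 (sumMap-zero all)) (+ᴿ-identityˡ 0#)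

    if-cong : ∀ {k k′ : Bool} {u u′} → k ≡ k′ → u ≈ u′ → (if k then u else 0#) ≈ (if k′ then u′ else 0#)
    if-cong {true}  refl u≈u′ = u≈u′
    if-cong {false} refl _    = ≈-refl

    if-zero : ∀ (k : Bool) {u} → u ≈ 0# → (if k then u else 0#) ≈ 0#
    if-zero true  u≈0 = u≈0
    if-zero false _   = ≈-refl

  bilinExt-boundedDegree : ∀ cond {a b} → BoundedDegree R a → BoundedDegree R b →
                           BoundedDegree R (bilinExt R cond a b)
  bilinExt-boundedDegree cond {a} {b} (Na , a-vanishes) (Nb , b-vanishes) =
    Na + Nb , λ m N<deg → sumMap-zero (All.map (term-vanishes m N<deg) (factorizations-degree m))
    where
    term-vanishes : ∀ m {pq} → Na + Nb < degree m → degree (proj₁ pq) + degree (proj₂ pq) ≡ degree m →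
                    term cond a b pq ≈ 0#
    term-vanishes m {p , q} N<deg deg≡ with +-<-split Na Nb (degree p) (degree q) (subst (Na + Nb <_) (sym deg≡) N<deg)
    ... | inj₁ Na<p = if-zero (cond p q) (≈-trans (*-congʳ (a-vanishes p Na<p)) (zeroˡ (b q)))
    ... | inj₂ Nb<q = if-zero (cond p q) (≈-trans (*-congˡ (b-vanishes q Nb<q)) (zeroʳ (a p)))

  bilinExt-packInvariant : ∀ {cond} → RespectsPadding cond → ∀ {a b} → PackInvariant a → PackInvariant b →
                           PackInvariant (bilinExt R cond a b)
  bilinExt-packInvariant {cond} respects {a} {b} a-inv b-inv m n m∼n =
    sumMap-cong (Pointwise.map similar-terms (factorizations-packEquiv respects m n m∼n))
    where
    similar-terms : ∀ {pq pq′} → SimilarFactors cond pq pq′ → term cond a b pq ≈ term cond a b pq′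
    similar-terms {p , q} {p′ , q′} (p∼p′ , q∼q′ , same-cond) =
      if-cong same-cond (*-cong (a-inv p p′ p∼p′) (b-inv q q′ q∼q′))

  bilinExt-QSym : ∀ {cond} → RespectsPadding cond → ∀ {a b} → QSym R a → QSym R b → QSym R (bilinExt R cond a b)
  bilinExt-QSym {cond} respects (a-bounded , a-inv) (b-bounded , b-inv) =
    bilinExt-boundedDegree cond a-bounded b-bounded , bilinExt-packInvariant respects a-inv b-inv

proposition3p5 : ∀ {c ℓ} (R : CommutativeRing c ℓ) (a b : PowerSeries R) →
    QSym R a → QSym R b → QSym R (_≺_ R a b) × QSym R (_▷_ R a b)
proposition3p5 R a b qa qb =
  bilinExt-QSym R precCond-respectsPadding qa qb , bilinExt-QSym R triCond-respectsPadding qa qb
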